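{- Let $r=s=1$, let $n$ be a positive integer, let $\sigma_0=(-n,0,0)$, and let $\sigma_t=(x(t),y(t),z(t))=f_{1,1}(\sigma_{t-1})$ for $t\ge1$. Suppose $a,b\in\mathbb{N}$ satisfy $a^2+n^2=b^2$. Then for $t=a+b-n$ we have $x(t)=-b$ and $y(t)=a$.
   Context: $\mathbb{N}$ denotes the nonnegative integers. In the one-dimensional rotor-router model with $r=s=1$, a particle starts at $0$, at each occupied site moves left if the label there is $L$ and right if it is $R$, then flips that label; on first reaching an unoccupied site (immediately left or right of the occupied interval) that site becomes occupied, labeled $R$; this defines $f_{1,1}$. Recurrent states are identified with integer triples $(x,y,z)$, $x\le0\le y$, $x\le z\le y$ (the state with occupied interval $[x,y]$, labels $R$ on $[x,z-1]$, $L$ on $[z,y-1]$, $R$ at $y$); on them $f_{1,1}(x,y,z)=(x,y+1,z-y)$ if $x+y\le z$ and $f_{1,1}(x,y,z)=(x-1,y,z-x+1)$ if $x+y>z$. So $(-n,0,0)$ is the state with occupied interval $[-n,0]$, all labeled $R$. -}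

module Defs where

open import Data.Integer using (ℤ; _+_; _-_; -_; +_; _≤?_)
open import Data.Nat using (ℕ; zero; suc)
open import Data.Product using (_×_; _,_)
open import Relation.Nullary using (yes; no)

-- Recurrent states of the 1-dim rotor-router model (r = s = 1),
-- encoded as integer triples (x , y , z) with x ≤ 0 ≤ y, x ≤ z ≤ y.
State : Set
State = ℤ × ℤ × ℤ

f₁₁ : State → State
f₁₁ (x , y , z) with (x + y) ≤? z
... | yes _ = (x , y + + 1 , z - y)
... | no  _ = (x - + 1 , y , (z - x) + + 1)

σ : ℕ → ℕ → State
σ n zero    = (- (+ n) , + 0 , + 0)
σ n (suc t) = f₁₁ (σ n t)

xOf yOf zOf : State → ℤ
xOf (x , _ , _) = x
yOf (_ , y , _) = y
zOf (_ , _ , z) = z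

-- Along the orbit the occupied interval [x, y] gains one site per step, and the
-- label boundary z stays a function of it: 2z = x(x-1) - y(y-1) - n(n+1), since
-- each step moves z by exactly the change of the right-hand side; moreover
-- x ≤ z ≤ y throughout.  At time t = a + b - n the width y - x is a + b, and after
-- substituting x = y - (a + b) and b² = a² + n², the inequalities x ≤ z ≤ y read
--   2(a+b+1)(y-a) ≤ a + 3b - n   and   2(a+b+1)(a-y) ≤ a + n - b.
-- Both right-hand sides are nonnegative (n ≤ b ≤ a + n) and add up to 2(a+b), so
-- each is below 2(a+b+1); hence y = a and x = a - (a + b) = -b.

module Submission where

open import Defs
open import Data.Product using (_×_; _,_)
open import Relation.Binary.PropositionalEquality
  using (_≡_; sym; trans; cong; cong₂; subst; module ≡-Reasoning)

module Orbit where

  open import Data.Nat as ℕ using (ℕ; zero; suc)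
  import Data.Nat.Properties as ℕ
  open import Data.Integer
    using (ℤ; +_; -_; _+_; _-_; _*_; _≤_; _<_; _≤?_; 0ℤ; 1ℤ; +≤+; +<+; NonNegative; nonNegative)
  open import Data.Integer.Properties
  open import Data.Integer.Tactic.RingSolver using (solve; solve-∀)
  open import Data.List using (_∷_; [])
  open import Relation.Nullary using (yes; no)

  twiceBoundary : ℤ → ℤ → ℤ → ℤ
  twiceBoundary m x y = x * (x - 1ℤ) - y * (y - 1ℤ) - m * (m + 1ℤ)

  record OrbitInvariant (n t : ℕ) (s : State) : Set where
    field
      x≤z      : xOf s ≤ zOf s
      z≤y      : zOf s ≤ yOf s
      x≤0      : xOf s ≤ 0ℤ
      0≤y      : 0ℤ ≤ yOf s
      width    : yOf s - xOf s ≡ + (n ℕ.+ t)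
      boundary : + 2 * zOf s ≡ twiceBoundary (+ n) (xOf s) (yOf s)

  width-suc : ∀ {n t} x y x′ y′ → y - x ≡ + (n ℕ.+ t) →
              y′ - x′ ≡ 1ℤ + (y - x) → y′ - x′ ≡ + (n ℕ.+ suc t)
  width-suc {n} {t} _ _ _ _ w grow =
    trans grow (trans (cong (λ d → 1ℤ + d) w) (cong +_ (sym (ℕ.+-suc n t))))

  boundary-growRight : ∀ m x y z → + 2 * z ≡ twiceBoundary m x y →
                       + 2 * (z - y) ≡ twiceBoundary m x (y + + 1)
  boundary-growRight m x y z b = begin
    + 2 * (z - y)                                             ≡⟨ solve (y ∷ z ∷ []) ⟩
    + 2 * z - + 2 * y                                         ≡⟨ cong (_- + 2 * y) b ⟩
    x * (x - 1ℤ) - y * (y - 1ℤ) - m * (m + 1ℤ) - + 2 * y     ≡⟨ solve (m ∷ x ∷ y ∷ []) ⟩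
    x * (x - 1ℤ) - (y + + 1) * (y + + 1 - 1ℤ) - m * (m + 1ℤ) ∎
    where open ≡-Reasoning

  boundary-growLeft : ∀ m x y z → + 2 * z ≡ twiceBoundary m x y →
                      + 2 * ((z - x) + + 1) ≡ twiceBoundary m (x - + 1) y
  boundary-growLeft m x y z b = begin
    + 2 * ((z - x) + + 1)                                            ≡⟨ solve (x ∷ z ∷ []) ⟩
    + 2 * z - + 2 * x + + 2                                          ≡⟨ cong (λ w → w - + 2 * x + + 2) b ⟩
    x * (x - 1ℤ) - y * (y - 1ℤ) - m * (m + 1ℤ) - + 2 * x + + 2      ≡⟨ solve (m ∷ x ∷ y ∷ []) ⟩
    (x - + 1) * (x - + 1 - 1ℤ) - y * (y - 1ℤ) - m * (m + 1ℤ)        ∎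
    where open ≡-Reasoning

  growRight : ∀ {n t x y z} → x + y ≤ z → OrbitInvariant n t (x , y , z) →
              OrbitInvariant n (suc t) (x , y + + 1 , z - y)
  growRight {n} {_} {x} {y} {z} x+y≤z I = record
    { x≤z      = begin x           ≡⟨ solve (x ∷ y ∷ []) ⟩
                       x + y - y   ≤⟨ +-monoˡ-≤ (- y) x+y≤z ⟩
                       z - y       ∎
    ; z≤y      = begin z - y       ≤⟨ i≤j⇒i-j≤0 z≤y ⟩
                       0ℤ          ≤⟨ 0≤y ⟩
                       y           ≤⟨ i≤i+j y (+ 1) ⟩
                       y + + 1     ∎
    ; x≤0      = x≤0
    ; 0≤y      = ≤-trans 0≤y (i≤i+j y (+ 1))
    ; width    = width-suc x y x (y + + 1) width (solve (x ∷ y ∷ []))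
    ; boundary = boundary-growRight (+ n) x y z boundary
    }
    where
    open OrbitInvariant I
    open ≤-Reasoning

  growLeft : ∀ {n t x y z} → z < x + y → OrbitInvariant n t (x , y , z) →
             OrbitInvariant n (suc t) (x - + 1 , y , (z - x) + + 1)
  growLeft {n} {_} {x} {y} {z} z<x+y I = record
    { x≤z      = begin x - + 1         ≤⟨ i≤j⇒i-k≤j (+ 1) x≤0 ⟩
                       0ℤ              ≤⟨ i≤j⇒0≤j-i x≤z ⟩
                       z - x           ≤⟨ i≤i+j (z - x) (+ 1) ⟩
                       (z - x) + + 1   ∎
    ; z≤y      = begin (z - x) + + 1   ≡⟨ solve (x ∷ z ∷ []) ⟩
                       (1ℤ + z) - x    ≤⟨ +-monoˡ-≤ (- x) (i<j⇒suc[i]≤j z<x+y) ⟩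
                       (x + y) - x     ≡⟨ solve (x ∷ y ∷ []) ⟩
                       y               ∎
    ; x≤0      = i≤j⇒i-k≤j (+ 1) x≤0
    ; 0≤y      = 0≤y
    ; width    = width-suc x y (x - + 1) y width (solve (x ∷ y ∷ []))
    ; boundary = boundary-growLeft (+ n) x y z boundary
    }
    where
    open OrbitInvariant I
    open ≤-Reasoning

  f₁₁-preserves : ∀ {n t} s → OrbitInvariant n t s → OrbitInvariant n (suc t) (f₁₁ s)
  f₁₁-preserves (x , y , z) I with x + y ≤? z
  ... | yes x+y≤z = growRight x+y≤z I
  ... | no  x+y≰z = growLeft (≰⇒> x+y≰z) I

  σ-invariant : ∀ n t → OrbitInvariant n t (σ n t)
  σ-invariant n zero = record
    { x≤z      = neg-≤-pos
    ; z≤y      = ≤-refl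
    ; x≤0      = neg-≤-pos
    ; 0≤y      = ≤-refl
    ; width    = trans (initial-width (+ n)) (cong +_ (sym (ℕ.+-identityʳ n)))
    ; boundary = initial-boundary (+ n)
    }
    where
    initial-width : ∀ m → 0ℤ - - m ≡ m
    initial-width = solve-∀
    initial-boundary : ∀ m → + 2 * 0ℤ ≡ (- m) * (- m - 1ℤ) - 0ℤ * (0ℤ - 1ℤ) - m * (m + 1ℤ)
    initial-boundary = solve-∀
  σ-invariant n (suc t) = f₁₁-preserves (σ n t) (σ-invariant n t)

  x≡y-width : ∀ {n t x y z} → OrbitInvariant n t (x , y , z) → x ≡ y - + (n ℕ.+ t)
  x≡y-width {n} {t} {x} {y} I = begin
    x            ≡⟨ solve (x ∷ y ∷ []) ⟩
    y - (y - x)  ≡⟨ cong (λ w → y - w) (OrbitInvariant.width I) ⟩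
    y - + (n ℕ.+ t) ∎
    where open ≡-Reasoning

  k*i<k⇒i≤0 : ∀ k .{{_ : NonNegative k}} {i} → k * i < k → i ≤ 0ℤ
  k*i<k⇒i≤0 k {i} k*i<k =
    i<j⇒i≤pred[j] (*-cancelˡ-<-nonNeg k (subst (k * i <_) (sym (*-identityʳ k)) k*i<k))

  squeeze : ∀ {p q d} → 0ℤ ≤ p → 0ℤ ≤ q →
            (p + q + + 2) * d ≤ p → (p + q + + 2) * - d ≤ q → d ≡ 0ℤ
  squeeze {p} {q} 0≤p 0≤q kd≤p k[-d]≤q =
    ≤-antisym (k*i<k⇒i≤0 k {{k≥0}} (≤-<-trans kd≤p p<k))
              (neg-cancel-≤ {j = 0ℤ} (k*i<k⇒i≤0 k {{k≥0}} (≤-<-trans k[-d]≤q q<k)))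
    where
    k : ℤ
    k = p + q + + 2
    i<i+2 : ∀ i → i < i + + 2
    i<i+2 i = ≤-<-trans (≤-reflexive (sym (+-identityʳ i))) (+-monoʳ-< i (+<+ (ℕ.s≤s ℕ.z≤n)))
    p<k : p < k
    p<k = ≤-<-trans (i≤i+j p q {{nonNegative 0≤q}}) (i<i+2 (p + q))
    q<k : q < k
    q<k = ≤-<-trans (i≤j+i q p {{nonNegative 0≤p}}) (i<i+2 (p + q))
    k≥0 : NonNegative k
    k≥0 = nonNegative (≤-trans 0≤p (<⇒≤ p<k))

  left-gap-at-width : ∀ A B N y →
    (y - (A + B)) * (y - (A + B) - 1ℤ) - y * (y - 1ℤ) - N * (N + 1ℤ) - + 2 * (y - (A + B))
      ≡ (A + B + B + B - N)
        - ((A + B + B + B - N) + (A + N - B) + + 2) * (y - A)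
        + (B * B - (A * A + N * N))
  left-gap-at-width = solve-∀

  right-gap-at-width : ∀ A B N y →
    + 2 * y - ((y - (A + B)) * (y - (A + B) - 1ℤ) - y * (y - 1ℤ) - N * (N + 1ℤ))
      ≡ (A + N - B)
        - ((A + B + B + B - N) + (A + N - B) + + 2) * - (y - A)
        - (B * B - (A * A + N * N))
  right-gap-at-width = solve-∀

  rightEnd-pinned : ∀ {a b n t x y z} → a ℕ.* a ℕ.+ n ℕ.* n ≡ b ℕ.* b →
                    n ℕ.≤ b → b ℕ.≤ a ℕ.+ n → n ℕ.+ t ≡ a ℕ.+ b →
                    OrbitInvariant n t (x , y , z) → y ≡ + a
  rightEnd-pinned {a} {b} {n} {_} {x} {y} {z} pythagorean n≤b b≤a+n n+t≡a+b I =
    i-j≡0⇒i≡j y (+ a) (squeeze 0≤p 0≤q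
      (0≤i-j⇒j≤i (subst (0ℤ ≤_) left-gap (i≤j⇒0≤j-i (*-monoˡ-≤-nonNeg (+ 2) x≤z))))
      (0≤i-j⇒j≤i (subst (0ℤ ≤_) right-gap (i≤j⇒0≤j-i (*-monoˡ-≤-nonNeg (+ 2) z≤y)))))
    where
    open OrbitInvariant I
    open ≡-Reasoning
    p q k d : ℤ
    p = + a + + b + + b + + b - + n
    q = + a + + n - + b
    k = p + q + + 2
    d = y - + a
    0≤p : 0ℤ ≤ p
    0≤p = i≤j⇒0≤j-i (+≤+ (ℕ.≤-trans n≤b (ℕ.m≤n+m b (a ℕ.+ b ℕ.+ b))))
    0≤q : 0ℤ ≤ q
    0≤q = i≤j⇒0≤j-i (+≤+ b≤a+n)
    pythagorean-defect : + b * + b - (+ a * + a + + n * + n) ≡ 0ℤ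
    pythagorean-defect = i≡j⇒i-j≡0 (begin
      + b * + b                    ≡⟨ sym (pos-* b b) ⟩
      + (b ℕ.* b)                  ≡⟨ cong +_ (sym pythagorean) ⟩
      + (a ℕ.* a ℕ.+ n ℕ.* n)      ≡⟨ cong₂ _+_ (pos-* a a) (pos-* n n) ⟩
      + a * + a + + n * + n        ∎)
    x≡y-[a+b] : x ≡ y - (+ a + + b)
    x≡y-[a+b] = trans (x≡y-width I) (cong (λ w → y - + w) n+t≡a+b)
    left-gap : + 2 * z - + 2 * x ≡ p - k * d
    left-gap = begin
      + 2 * z - + 2 * x
        ≡⟨ cong (λ u → u - + 2 * x) boundary ⟩
      twiceBoundary (+ n) x y - + 2 * x
        ≡⟨ cong (λ v → twiceBoundary (+ n) v y - + 2 * v) x≡y-[a+b] ⟩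
      twiceBoundary (+ n) (y - (+ a + + b)) y - + 2 * (y - (+ a + + b))
        ≡⟨ left-gap-at-width (+ a) (+ b) (+ n) y ⟩
      p - k * d + (+ b * + b - (+ a * + a + + n * + n))
        ≡⟨ cong (λ e → p - k * d + e) pythagorean-defect ⟩
      p - k * d + 0ℤ
        ≡⟨ +-identityʳ _ ⟩
      p - k * d
        ∎
    right-gap : + 2 * y - + 2 * z ≡ q - k * - d
    right-gap = begin
      + 2 * y - + 2 * z
        ≡⟨ cong (λ u → + 2 * y - u) boundary ⟩
      + 2 * y - twiceBoundary (+ n) x y
        ≡⟨ cong (λ v → + 2 * y - twiceBoundary (+ n) v y) x≡y-[a+b] ⟩
      + 2 * y - twiceBoundary (+ n) (y - (+ a + + b)) y
        ≡⟨ right-gap-at-width (+ a) (+ b) (+ n) y ⟩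
      q - k * - d - (+ b * + b - (+ a * + a + + n * + n))
        ≡⟨ cong (λ e → q - k * - d - e) pythagorean-defect ⟩
      q - k * - d - 0ℤ
        ≡⟨ +-identityʳ _ ⟩
      q - k * - d
        ∎

  endpoints-at-width : ∀ {a b n t} → a ℕ.* a ℕ.+ n ℕ.* n ≡ b ℕ.* b →
                       n ℕ.≤ b → b ℕ.≤ a ℕ.+ n → n ℕ.+ t ≡ a ℕ.+ b →
                       xOf (σ n t) ≡ - + b × yOf (σ n t) ≡ + a
  endpoints-at-width {a} {b} {n} {t} pythagorean n≤b b≤a+n n+t≡a+b with σ n t | σ-invariant n t
  ... | (x , y , _) | I = x≡-b , y≡a
    where
    open ≡-Reasoning
    y≡a : y ≡ + a
    y≡a = rightEnd-pinned pythagorean n≤b b≤a+n n+t≡a+b I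
    i-[i+j]≡-j : ∀ i j → i - (i + j) ≡ - j
    i-[i+j]≡-j = solve-∀
    x≡-b : x ≡ - + b
    x≡-b = begin
      x                 ≡⟨ x≡y-width I ⟩
      y - + (n ℕ.+ t)   ≡⟨ cong₂ (λ u w → u - + w) y≡a n+t≡a+b ⟩
      + a - (+ a + + b) ≡⟨ i-[i+j]≡-j (+ a) (+ b) ⟩
      - + b             ∎

open import Data.Nat using (ℕ; _+_; _*_; _∸_; _>_; _≤_)
open import Data.Nat.Properties
  using (≮⇒≥; <⇒≱; *-mono-<; m≤m+n; m≤n+m; ≤-trans; m+[n∸m]≡n; module ≤-Reasoning)
open import Data.Nat.Tactic.RingSolver using (solve)
open import Data.Integer using (+_; -_)
open import Data.List using (_∷_; [])
open Orbit using (endpoints-at-width)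

m*m≤n*n⇒m≤n : ∀ {m n} → m * m ≤ n * n → m ≤ n
m*m≤n*n⇒m≤n m*m≤n*n = ≮⇒≥ (λ n<m → <⇒≱ (*-mono-< n<m n<m) m*m≤n*n)

leg≤hypotenuse : ∀ a b n → a * a + n * n ≡ b * b → n ≤ b
leg≤hypotenuse a b n pythagorean =
  m*m≤n*n⇒m≤n (subst (n * n ≤_) pythagorean (m≤n+m (n * n) (a * a)))

hypotenuse≤leg+leg : ∀ a b n → a * a + n * n ≡ b * b → b ≤ a + n
hypotenuse≤leg+leg a b n pythagorean = m*m≤n*n⇒m≤n (begin
  b * b                         ≡⟨ sym pythagorean ⟩
  a * a + n * n                 ≤⟨ m≤m+n (a * a + n * n) (2 * a * n) ⟩
  a * a + n * n + 2 * a * n     ≡⟨ solve (a ∷ n ∷ []) ⟩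
  (a + n) * (a + n)             ∎)
  where open ≤-Reasoning

proposition3p5 : (n a b : ℕ) → n > 0 → a * a + n * n ≡ b * b →
    xOf (σ n ((a + b) ∸ n)) ≡ - (+ b) × yOf (σ n ((a + b) ∸ n)) ≡ + a
proposition3p5 n a b _ pythagorean =
  endpoints-at-width pythagorean n≤b (hypotenuse≤leg+leg a b n pythagorean)
    (m+[n∸m]≡n (≤-trans n≤b (m≤n+m b a)))
  where
  n≤b : n ≤ b
  n≤b = leg≤hypotenuse a b n pythagorean
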